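{- Let $G$ be a finite simple graph that is $\{2K_2, K_1+C_4\}$-free and satisfies $\omega(G)\geq 3$. Then $\chi(G)\leq \omega(G)+1$.
   Context: $\chi(G)$ is the chromatic number and $\omega(G)$ the clique number of $G$. $2K_2$ is the disjoint union of two edges. For graphs $G_1,G_2$, the join $G_1+G_2$ is their disjoint union together with all edges between $V(G_1)$ and $V(G_2)$; thus $K_1+C_4$ is the wheel on five vertices (a $4$-cycle plus a vertex adjacent to all four cycle vertices). A graph is $\mathcal{F}$-free if it has no induced subgraph isomorphic to a member of $\mathcal{F}$. -}

module Defs where

open import Data.Nat using (ℕ; suc; _≤_)
open import Data.Fin using (Fin; zero; suc)
open import Data.Bool using (Bool; true; false)
open import Data.Product using (Σ; ∃; _×_; _,_)
open import Relation.Binary.PropositionalEquality using (_≡_)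
open import Relation.Nullary using (¬_)
open import Function.Definitions using (Injective)

record Graph : Set where
  field
    n      : ℕ
    adj    : Fin n → Fin n → Bool
    sym    : ∀ u v → adj u v ≡ adj v u
    irrefl : ∀ v → adj v v ≡ false
open Graph public

InducedSub : Graph → Graph → Set
InducedSub H G =
  Σ (Fin (n H) → Fin (n G)) λ f →
    Injective _≡_ _≡_ f × (∀ u v → adj G (f u) (f v) ≡ adj H u v)

adj2K2 : Fin 4 → Fin 4 → Bool
adj2K2 zero (suc zero) = true
adj2K2 (suc zero) zero = true
adj2K2 (suc (suc zero)) (suc (suc (suc zero))) = true
adj2K2 (suc (suc (suc zero))) (suc (suc zero)) = true
adj2K2 _ _ = false

2K2 : Graph
2K2 = record
  { n = 4 ; adj = adj2K2
  ; sym = λ { zero zero → _≡_.refl ; zero (suc zero) → _≡_.refl ; zero (suc (suc zero)) → _≡_.refl ; zero (suc (suc (suc zero))) → _≡_.refl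
            ; (suc zero) zero → _≡_.refl ; (suc zero) (suc zero) → _≡_.refl ; (suc zero) (suc (suc zero)) → _≡_.refl ; (suc zero) (suc (suc (suc zero))) → _≡_.refl
            ; (suc (suc zero)) zero → _≡_.refl ; (suc (suc zero)) (suc zero) → _≡_.refl ; (suc (suc zero)) (suc (suc zero)) → _≡_.refl ; (suc (suc zero)) (suc (suc (suc zero))) → _≡_.refl
            ; (suc (suc (suc zero))) zero → _≡_.refl ; (suc (suc (suc zero))) (suc zero) → _≡_.refl ; (suc (suc (suc zero))) (suc (suc zero)) → _≡_.refl ; (suc (suc (suc zero))) (suc (suc (suc zero))) → _≡_.refl }
  ; irrefl = λ { zero → _≡_.refl ; (suc zero) → _≡_.refl ; (suc (suc zero)) → _≡_.refl ; (suc (suc (suc zero))) → _≡_.refl }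
  }

-- K₁ + C₄ (the 5-wheel): vertex 0 adjacent to all; cycle 1-2-3-4-1.
adjW : Fin 5 → Fin 5 → Bool
adjW zero zero = false
adjW zero (suc _) = true
adjW (suc _) zero = true
adjW (suc zero) (suc (suc zero)) = true
adjW (suc (suc zero)) (suc zero) = true
adjW (suc (suc zero)) (suc (suc (suc zero))) = true
adjW (suc (suc (suc zero))) (suc (suc zero)) = true
adjW (suc (suc (suc zero))) (suc (suc (suc (suc zero)))) = true
adjW (suc (suc (suc (suc zero)))) (suc (suc (suc zero))) = true
adjW (suc (suc (suc (suc zero)))) (suc zero) = true
adjW (suc zero) (suc (suc (suc (suc zero)))) = true
adjW _ _ = false

allFin5 : (P : Fin 5 → Set) → P zero → P (suc zero) → P (suc (suc zero))
        → P (suc (suc (suc zero))) → P (suc (suc (suc (suc zero)))) → ∀ v → P v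
allFin5 P a b c d e zero = a
allFin5 P a b c d e (suc zero) = b
allFin5 P a b c d e (suc (suc zero)) = c
allFin5 P a b c d e (suc (suc (suc zero))) = d
allFin5 P a b c d e (suc (suc (suc (suc zero)))) = e

symW : ∀ u v → adjW u v ≡ adjW v u
symW = allFin5 _
  (allFin5 _ _≡_.refl _≡_.refl _≡_.refl _≡_.refl _≡_.refl)
  (allFin5 _ _≡_.refl _≡_.refl _≡_.refl _≡_.refl _≡_.refl)
  (allFin5 _ _≡_.refl _≡_.refl _≡_.refl _≡_.refl _≡_.refl)
  (allFin5 _ _≡_.refl _≡_.refl _≡_.refl _≡_.refl _≡_.refl)
  (allFin5 _ _≡_.refl _≡_.refl _≡_.refl _≡_.refl _≡_.refl)

K1+C4 : Graph
K1+C4 = record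
  { n = 5 ; adj = adjW ; sym = symW
  ; irrefl = allFin5 _ _≡_.refl _≡_.refl _≡_.refl _≡_.refl _≡_.refl }

2K2-K1+C4-free : Graph → Set
2K2-K1+C4-free G = ¬ InducedSub 2K2 G × ¬ InducedSub K1+C4 G

HasClique : Graph → ℕ → Set
HasClique G k =
  Σ (Fin k → Fin (n G)) λ f →
    Injective _≡_ _≡_ f × (∀ i j → ¬ i ≡ j → adj G (f i) (f j) ≡ true)

CliqueNumber : Graph → ℕ → Set
CliqueNumber G w = HasClique G w × (∀ k → HasClique G k → k ≤ w)

Colourable : Graph → ℕ → Set
Colourable G k =
  Σ (Fin (n G) → Fin k) λ c → ∀ u v → adj G u v ≡ true → ¬ c u ≡ c v

-- Fix a maximum clique f(0), …, f(w−1); every other vertex misses some clique vertex,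
-- else the clique would grow. Clique vertices keep their index as colour, vertices
-- missing exactly one clique vertex share the extra colour w, and a vertex missing
-- several takes the index c of a missed clique vertex whose cyclic successor f(c+1)
-- it sees (any missed index if it sees none). Two adjacent vertices of colour w give a
-- clique of size w+1 if they miss the same vertex, and otherwise a K₁+C₄ whose hub is
-- a third clique vertex (this is where w ≥ 3 is needed). For two adjacent vertices of
-- colour c, each sees a clique vertex missed by the other, since two common misses
-- would span a 2K₂ with them; in particular neither is blind to the clique, so both
-- see f(c+1), and the two vertices with those two clique vertices form a C₄ around it.
module Submission where

open import Defs hiding (sym)
open import Data.Nat using (ℕ; zero; suc; _+_; _≤_; z≤n; s≤s)
open import Data.Nat.Properties using (1+n≰n)
open import Data.Fin using (Fin; zero; suc; fromℕ; inject₁; punchIn; _≟_) renaming (_≤_ to _≤ᶠ_)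
open import Data.Fin.Properties
  using (any?; all?; ≤fromℕ; fromℕ≢inject₁; inject₁-injective; punchIn-injective; punchInᵢ≢i)
open import Data.Vec.Functional using (_∷_)
open import Data.Bool using (Bool; true; false)
import Data.Bool.Properties as Bool
open import Data.Product using (∃; ∃₂; _×_; _,_; proj₁; proj₂; map)
open import Data.Sum using (_⊎_; inj₁; inj₂)
open import Data.Empty using (⊥; ⊥-elim)
open import Function using (_∘_; id)
open import Function.Definitions using (Injective)
open import Relation.Binary.PropositionalEquality
  using (_≡_; _≢_; refl; sym; trans; cong; subst; ≢-sym)
open import Relation.Nullary using (¬?; yes; no; contradiction)
open import Relation.Nullary.Decidable
  using (from-yes; decidable-stable; _→-dec_; _⊎-dec_; _×-dec_)

private
  variable
    k m : ℕ

-- i ↦ i + 1 modulo m + 1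
cycSuc : Fin (suc m) → Fin (suc m)
cycSuc {zero}  zero    = zero
cycSuc {suc m} zero    = suc zero
cycSuc {suc m} (suc i) with cycSuc i
... | zero  = zero
... | suc j = suc (suc j)

cycSuc-inject₁ : (i : Fin m) → cycSuc (inject₁ i) ≡ suc i
cycSuc-inject₁ {suc m} zero                      = refl
cycSuc-inject₁ {suc m} (suc i) rewrite cycSuc-inject₁ i = refl

cycSuc-fromℕ : ∀ m → cycSuc (fromℕ m) ≡ zero
cycSuc-fromℕ zero                             = refl
cycSuc-fromℕ (suc m) rewrite cycSuc-fromℕ m = refl

Ascent : (Fin (suc m) → Bool) → Fin m → Set
Ascent g c = g (inject₁ c) ≡ false × g (suc c) ≡ true

CyclicAscent : (Fin (suc m) → Bool) → Fin (suc m) → Set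
CyclicAscent g c = g c ≡ false × g (cycSuc c) ≡ true

ascent : (g : Fin (suc m) → Bool) {i j : Fin (suc m)} → i ≤ᶠ j → g i ≡ false → g j ≡ true →
         ∃ (Ascent g)
ascent         g {zero}  {zero}  _ gi gj = contradiction (trans (sym gi) gj) λ ()
ascent {suc m} g {zero}  {suc j} _ gi gj with g (suc zero) in g1
... | true  = zero , gi , g1
... | false = map suc id (ascent (g ∘ suc) z≤n g1 gj)
ascent {suc m} g {suc i} {suc j} (s≤s i≤j) gi gj = map suc id (ascent (g ∘ suc) i≤j gi gj)

ascent⇒cyclicAscent : (g : Fin (suc m) → Bool) {c : Fin m} → Ascent g c → CyclicAscent g (inject₁ c)
ascent⇒cyclicAscent g {c} (gc , gc+1) = gc , subst (λ d → g d ≡ true) (sym (cycSuc-inject₁ c)) gc+1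

cyclicAscent : (g : Fin (suc m) → Bool) {i j : Fin (suc m)} → g i ≡ false → g j ≡ true →
               ∃ (CyclicAscent g)
cyclicAscent {m} g {i} {j} gi gj with g (fromℕ m) in gLast | g zero in gFirst
... | true  | _     = map inject₁ (ascent⇒cyclicAscent g) (ascent g (≤fromℕ i) gi gLast)
... | false | true  = fromℕ m , gLast , subst (λ d → g d ≡ true) (sym (cycSuc-fromℕ m)) gFirst
... | false | false = map inject₁ (ascent⇒cyclicAscent g) (ascent g z≤n gFirst gj)

Anchor : (Fin (suc m) → Bool) → Fin (suc m) → Set
Anchor g c = g c ≡ false × (g (cycSuc c) ≡ true ⊎ ∀ j → g j ≡ false)

anchor : (g : Fin (suc m) → Bool) {a : Fin (suc m)} → g a ≡ false → ∃ (Anchor g)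
anchor g {a} ga with any? (λ j → g j Bool.≟ true)
... | yes (j , gj) = map id (map id inj₁) (cyclicAscent g ga gj)
... | no  ∄true    = a , ga , inj₂ (λ j → Bool.¬-not (∄true ∘ (j ,_)))

UniqueFalse : (Fin k → Bool) → Fin k → Set
UniqueFalse g a = g a ≡ false × (∀ j → g j ≡ false → j ≡ a)

TwoFalse : (Fin k → Bool) → Set
TwoFalse g = ∃₂ λ a b → a ≢ b × g a ≡ false × g b ≡ false

falses-trichotomy : (g : Fin k → Bool) → (∀ j → g j ≡ true) ⊎ ∃ (UniqueFalse g) ⊎ TwoFalse g
falses-trichotomy g with any? (λ j → g j Bool.≟ false)
... | no ∄false = inj₁ (λ j → Bool.¬-not (∄false ∘ (j ,_)))
... | yes (a , ga) with any? (λ b → ¬? (b ≟ a) ×-dec g b Bool.≟ false)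
...   | yes (b , b≢a , gb) = inj₂ (inj₂ (a , b , ≢-sym b≢a , ga , gb))
...   | no  ∄other         =
  inj₂ (inj₁ (a , ga , λ j gj → decidable-stable (j ≟ a) (λ j≢a → ∄other (j , j≢a , gj))))

avoid₂ : (a b : Fin (3 + k)) → ∃ λ c → c ≢ a × c ≢ b
avoid₂ a b with zero ≟ a | zero ≟ b
... | no 0≢a   | no 0≢b = zero , 0≢a , 0≢b
... | yes refl | _ with suc zero ≟ b
...   | no 1≢b   = suc zero , (λ ()) , 1≢b
...   | yes refl = suc (suc zero) , (λ ()) , (λ ())
avoid₂ a b | no 0≢a | yes refl with suc zero ≟ a
...   | no 1≢a   = suc zero , 1≢a , (λ ())
...   | yes refl = suc (suc zero) , (λ ()) , (λ ())

Twins : (H : Graph) → Fin (n H) → Fin (n H) → Set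
Twins H u v = ∀ z → adj H z u ≡ adj H z v

module Embedding (H G : Graph) (h : Fin (n H) → Fin (n G))
                 (preserves : ∀ u v → adj G (h u) (h v) ≡ adj H u v) where

  collision⇒twins : ∀ {u v} → h u ≡ h v → Twins H u v
  collision⇒twins {u} {v} hu≡hv z =
    trans (sym (preserves z u)) (trans (cong (adj G (h z)) hu≡hv) (preserves z v))

  inducedSub : (∀ {u v} → Twins H u v → u ≢ v → h u ≢ h v) → InducedSub H G
  inducedSub twins-apart = h , injective , preserves
    where
    injective : Injective _≡_ _≡_ h
    injective {u} {v} hu≡hv =
      decidable-stable (u ≟ v) λ u≢v → twins-apart (collision⇒twins hu≡hv) u≢v hu≡hv

2K2-twins : ∀ u v → Twins 2K2 u v → u ≡ v
2K2-twins = from-yes (all? λ u → all? λ v → all? (λ z → adj2K2 z u Bool.≟ adj2K2 z v) →-dec u ≟ v)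

antipode : Fin 5 → Fin 5
antipode zero                             = zero
antipode (suc zero)                       = suc (suc (suc zero))
antipode (suc (suc zero))                 = suc (suc (suc (suc zero)))
antipode (suc (suc (suc zero)))           = suc zero
antipode (suc (suc (suc (suc zero))))     = suc (suc zero)

K1+C4-twins : ∀ u v → Twins K1+C4 u v → v ≡ u ⊎ v ≡ antipode u
K1+C4-twins = from-yes (all? λ u → all? λ v →
  all? (λ z → adjW z u Bool.≟ adjW z v) →-dec (v ≟ u ⊎-dec v ≟ antipode u))

module Adjacency (G : Graph) where

  V : Set
  V = Fin (n G)

  _~_ _≁_ : V → V → Set
  u ~ v = adj G u v ≡ true
  u ≁ v = adj G u v ≡ false

  private
    variable
      u v z : V

  ~-sym : u ~ v → v ~ u
  ~-sym {u} {v} = trans (Graph.sym G v u)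

  ≁-sym : u ≁ v → v ≁ u
  ≁-sym {u} {v} = trans (Graph.sym G v u)

  ~⇒≢ : u ~ v → u ≢ v
  ~⇒≢ {u} u~u refl = contradiction (trans (sym u~u) (irrefl G u)) λ ()

  ~≁⇒≢ : u ~ z → v ≁ z → u ≢ v
  ~≁⇒≢ u~z u≁z refl = contradiction (trans (sym u~z) u≁z) λ ()

  2K2-at : (p q r s : V) → p ~ q → r ~ s → p ≁ r → p ≁ s → q ≁ r → q ≁ s → InducedSub 2K2 G
  2K2-at p q r s pq rs pr ps qr qs = inducedSub λ {u} {v} tw → contradiction (2K2-twins u v tw)
    where
    h : Fin 4 → V
    h zero                   = p
    h (suc zero)             = q
    h (suc (suc zero))       = r
    h (suc (suc (suc zero))) = s
    preserves : ∀ u v → adj G (h u) (h v) ≡ adj2K2 u v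
    preserves zero                   zero                   = irrefl G p
    preserves zero                   (suc zero)             = pq
    preserves zero                   (suc (suc zero))       = pr
    preserves zero                   (suc (suc (suc zero))) = ps
    preserves (suc zero)             zero                   = ~-sym pq
    preserves (suc zero)             (suc zero)             = irrefl G q
    preserves (suc zero)             (suc (suc zero))       = qr
    preserves (suc zero)             (suc (suc (suc zero))) = qs
    preserves (suc (suc zero))       zero                   = ≁-sym pr
    preserves (suc (suc zero))       (suc zero)             = ≁-sym qr
    preserves (suc (suc zero))       (suc (suc zero))       = irrefl G r
    preserves (suc (suc zero))       (suc (suc (suc zero))) = rs
    preserves (suc (suc (suc zero))) zero                   = ≁-sym ps
    preserves (suc (suc (suc zero))) (suc zero)             = ≁-sym qs
    preserves (suc (suc (suc zero))) (suc (suc zero))       = ~-sym rs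
    preserves (suc (suc (suc zero))) (suc (suc (suc zero))) = irrefl G s
    open Embedding 2K2 G h preserves

  K1+C4-at : (c r₁ r₂ r₃ r₄ : V) → c ~ r₁ → c ~ r₂ → c ~ r₃ → c ~ r₄ →
             r₁ ~ r₂ → r₂ ~ r₃ → r₃ ~ r₄ → r₄ ~ r₁ → r₁ ≁ r₃ → r₂ ≁ r₄ → r₁ ≢ r₃ → r₂ ≢ r₄ →
             InducedSub K1+C4 G
  K1+C4-at c r₁ r₂ r₃ r₄ cr1 cr2 cr3 cr4 r12 r23 r34 r41 r13 r24 r₁≢r₃ r₂≢r₄ = inducedSub twins-apart
    where
    h : Fin 5 → V
    h zero                         = c
    h (suc zero)                   = r₁
    h (suc (suc zero))             = r₂
    h (suc (suc (suc zero)))       = r₃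
    h (suc (suc (suc (suc zero)))) = r₄
    preserves : ∀ u v → adj G (h u) (h v) ≡ adjW u v
    preserves zero                         zero                         = irrefl G c
    preserves zero                         (suc zero)                   = cr1
    preserves zero                         (suc (suc zero))             = cr2
    preserves zero                         (suc (suc (suc zero)))       = cr3
    preserves zero                         (suc (suc (suc (suc zero)))) = cr4
    preserves (suc zero)                   zero                         = ~-sym cr1
    preserves (suc zero)                   (suc zero)                   = irrefl G r₁
    preserves (suc zero)                   (suc (suc zero))             = r12
    preserves (suc zero)                   (suc (suc (suc zero)))       = r13
    preserves (suc zero)                   (suc (suc (suc (suc zero)))) = ~-sym r41
    preserves (suc (suc zero))             zero                         = ~-sym cr2
    preserves (suc (suc zero))             (suc zero)                   = ~-sym r12
    preserves (suc (suc zero))             (suc (suc zero))             = irrefl G r₂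
    preserves (suc (suc zero))             (suc (suc (suc zero)))       = r23
    preserves (suc (suc zero))             (suc (suc (suc (suc zero)))) = r24
    preserves (suc (suc (suc zero)))       zero                         = ~-sym cr3
    preserves (suc (suc (suc zero)))       (suc zero)                   = ≁-sym r13
    preserves (suc (suc (suc zero)))       (suc (suc zero))             = ~-sym r23
    preserves (suc (suc (suc zero)))       (suc (suc (suc zero)))       = irrefl G r₃
    preserves (suc (suc (suc zero)))       (suc (suc (suc (suc zero)))) = r34
    preserves (suc (suc (suc (suc zero)))) zero                         = ~-sym cr4
    preserves (suc (suc (suc (suc zero)))) (suc zero)                   = r41
    preserves (suc (suc (suc (suc zero)))) (suc (suc zero))             = ≁-sym r24
    preserves (suc (suc (suc (suc zero)))) (suc (suc (suc zero)))       = ~-sym r34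
    preserves (suc (suc (suc (suc zero)))) (suc (suc (suc (suc zero)))) = irrefl G r₄
    open Embedding K1+C4 G h preserves
    antipodes-apart : ∀ u → u ≢ antipode u → h u ≢ h (antipode u)
    antipodes-apart zero                         u≢u = contradiction refl u≢u
    antipodes-apart (suc zero)                   _   = r₁≢r₃
    antipodes-apart (suc (suc zero))             _   = r₂≢r₄
    antipodes-apart (suc (suc (suc zero)))       _   = r₁≢r₃ ∘ sym
    antipodes-apart (suc (suc (suc (suc zero)))) _   = r₂≢r₄ ∘ sym
    twins-apart : ∀ {u v} → Twins K1+C4 u v → u ≢ v → h u ≢ h v
    twins-apart {u} {v} tw u≢v with K1+C4-twins u v tw
    ... | inj₁ refl = contradiction refl u≢v
    ... | inj₂ refl = antipodes-apart u u≢v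

  IsClique : (Fin k → V) → Set
  IsClique h = Injective _≡_ _≡_ h × (∀ i j → i ≢ j → h i ~ h j)

  clique-∘ : {h : Fin k → V} → IsClique h → (g : Fin m → Fin k) → Injective _≡_ _≡_ g →
             IsClique (h ∘ g)
  clique-∘ (h-inj , h-adj) g g-inj = g-inj ∘ h-inj , λ i j i≢j → h-adj (g i) (g j) (i≢j ∘ g-inj)

  clique-∷ : {h : Fin k → V} → IsClique h → (∀ i → h i ≢ v) → (∀ i → h i ~ v) → IsClique (v ∷ h)
  clique-∷ {v = v} {h} (h-inj , h-adj) fresh adjacent = injective , adjacent′
    where
    injective : Injective _≡_ _≡_ (v ∷ h)
    injective {zero}  {zero}  _ = refl
    injective {zero}  {suc j} e = contradiction (sym e) (fresh j)
    injective {suc i} {zero}  e = contradiction e (fresh i)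
    injective {suc i} {suc j} e = cong suc (h-inj e)
    adjacent′ : ∀ i j → i ≢ j → (v ∷ h) i ~ (v ∷ h) j
    adjacent′ zero    zero    i≢i = contradiction refl i≢i
    adjacent′ zero    (suc j) _   = ~-sym (adjacent j)
    adjacent′ (suc i) zero    _   = adjacent i
    adjacent′ (suc i) (suc j) i≢j = h-adj i j (i≢j ∘ cong suc)

module Colouring (G : Graph) (free : 2K2-K1+C4-free G) {k : ℕ} (f : Fin (3 + k) → Fin (n G))
                 (clique : Adjacency.IsClique G f) (maximum : ∀ m → HasClique G m → m ≤ 3 + k) where

  open Adjacency G

  private
    w : ℕ
    w = 3 + k
    variable
      x y : V
      a b c : Fin w

  row : V → Fin w → Bool
  row v j = adj G (f j) v

  Outside : V → Set
  Outside v = ∀ i → f i ≢ v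

  edge : ∀ i j → i ≢ j → f i ~ f j
  edge = proj₂ clique

  no-extension : {h : Fin w → V} → IsClique h → (∀ i → h i ≢ x) → (∀ i → h i ~ x) → ⊥
  no-extension {x = x} {h} h-clique fresh adjacent =
    1+n≰n (maximum _ (x ∷ h , clique-∷ h-clique fresh adjacent))

  sees : (∀ j → row x j ≡ false → j ≡ a) → ∀ j → j ≢ a → f j ~ x
  sees only-a j j≢a = Bool.¬-not (j≢a ∘ only-a j)

  commonMisses : x ~ y → a ≢ b → f a ≁ x → f b ≁ x → f a ≁ y → f b ≁ y → ⊥
  commonMisses {x} {y} {a} {b} x~y a≢b ax bx ay by =
    proj₁ free (2K2-at x y (f a) (f b) x~y (edge a b a≢b) (≁-sym ax) (≁-sym bx) (≁-sym ay) (≁-sym by))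

  seenByOther : x ~ y → a ≢ b → f a ≁ x → f b ≁ x → ∃ λ p → f p ≁ x × f p ~ y
  seenByOther {x} {y} {a} {b} x~y a≢b ax bx with adj G (f a) y in ay | adj G (f b) y in by
  ... | true  | _     = a , ax , ay
  ... | false | true  = b , bx , by
  ... | false | false = ⊥-elim (commonMisses x~y a≢b ax bx ay by)

  sameMiss : x ~ y → Outside x → Outside y → UniqueFalse (row x) a → UniqueFalse (row y) a → ⊥
  sameMiss {x} {y} {a} x~y out-x out-y (_ , only-x) (_ , only-y) =
    no-extension (clique-∷ rest (out-x ∘ punchIn a) (sees-punched only-x)) fresh adjacent
    where
    rest : IsClique (f ∘ punchIn a)
    rest = clique-∘ clique (punchIn a) (punchIn-injective a _ _)
    sees-punched : ∀ {v} → (∀ j → row v j ≡ false → j ≡ a) → ∀ j → f (punchIn a j) ~ v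
    sees-punched only-a j = sees only-a (punchIn a j) (punchInᵢ≢i a j)
    fresh : ∀ i → (x ∷ f ∘ punchIn a) i ≢ y
    fresh zero    = ~⇒≢ x~y
    fresh (suc j) = out-y (punchIn a j)
    adjacent : ∀ i → (x ∷ f ∘ punchIn a) i ~ y
    adjacent zero    = x~y
    adjacent (suc j) = sees-punched only-y j

  differentMisses : x ~ y → Outside x → Outside y → a ≢ b →
                    UniqueFalse (row x) a → UniqueFalse (row y) b → ⊥
  differentMisses {x} {y} {a} {b} x~y out-x out-y a≢b (ax , only-x) (by , only-y)
    with avoid₂ a b
  ... | c , c≢a , c≢b =
    proj₂ free (K1+C4-at (f c) x (f b) (f a) y
      (sees only-x c c≢a) (edge c b c≢b) (edge c a c≢a) (sees only-y c c≢b)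
      (~-sym (sees only-x b (≢-sym a≢b))) (edge b a (≢-sym a≢b)) (sees only-y a a≢b) (~-sym x~y)
      (≁-sym ax) by (out-x a ∘ sym) (out-y b))

  oneMiss-conflict : x ~ y → Outside x → Outside y →
                     UniqueFalse (row x) a → UniqueFalse (row y) b → ⊥
  oneMiss-conflict {a = a} {b} x~y out-x out-y miss-x miss-y with a ≟ b
  ... | yes refl = sameMiss x~y out-x out-y miss-x miss-y
  ... | no  a≢b  = differentMisses x~y out-x out-y a≢b miss-x miss-y

  sharedAnchor-conflict : x ~ y → Outside x → Outside y → TwoFalse (row x) → TwoFalse (row y) →
                          Anchor (row x) c → Anchor (row y) c → ⊥
  sharedAnchor-conflict x~y _ _ _ (a , b , a≢b , ay , by) (_ , inj₂ blind-x) _ =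
    commonMisses x~y a≢b (blind-x a) (blind-x b) ay by
  sharedAnchor-conflict x~y _ _ (a , b , a≢b , ax , bx) _ _ (_ , inj₂ blind-y) =
    commonMisses x~y a≢b ax bx (blind-y a) (blind-y b)
  sharedAnchor-conflict {x} {y} {c} x~y out-x out-y (a , b , a≢b , ax , bx) (a′ , b′ , a′≢b′ , a′y , b′y)
                        (_ , inj₁ dx) (_ , inj₁ dy)
    with seenByOther x~y a≢b ax bx | seenByOther (~-sym x~y) a′≢b′ a′y b′y
  ... | p , px , py | q , qy , qx =
    proj₂ free (K1+C4-at (f d) x y (f p) (f q)
      dx dy (edge d p (~≁⇒≢ dx px ∘ cong f)) (edge d q (~≁⇒≢ dy qy ∘ cong f))
      x~y (~-sym py) (edge p q (~≁⇒≢ py qy ∘ cong f)) qx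
      (≁-sym px) (≁-sym qy) (out-x p ∘ sym) (out-y q ∘ sym))
    where
    d : Fin w
    d = cycSuc c

  data Class (v : V) : Set where
    member   : (i : Fin w) → f i ≡ v → Class v
    oneMiss  : Outside v → (a : Fin w) → UniqueFalse (row v) a → Class v
    manyMiss : Outside v → TwoFalse (row v) → (c : Fin w) → Anchor (row v) c → Class v

  colour : Class x → Fin (suc w)
  colour (member i _)       = inject₁ i
  colour (oneMiss _ _ _)    = fromℕ w
  colour (manyMiss _ _ c _) = inject₁ c

  classifyOutside : Outside x → Class x
  classifyOutside {x} out with falses-trichotomy (row x)
  ... | inj₁ sees-all = ⊥-elim (no-extension clique out sees-all)
  ... | inj₂ (inj₁ (a , unique)) = oneMiss out a unique
  ... | inj₂ (inj₂ two@(a , _ , _ , ax , _)) with anchor (row x) ax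
  ...   | c , anc = manyMiss out two c anc

  classify : ∀ x → Class x
  classify x with any? (λ i → f i ≟ x)
  ... | yes (i , fi≡x) = member i fi≡x
  ... | no  ∄i         = classifyOutside (λ i fi≡x → ∄i (i , fi≡x))

  proper : x ~ y → (cx : Class x) (cy : Class y) → colour cx ≢ colour cy
  proper x~y (member _ refl) (member _ refl) e = ~⇒≢ x~y (cong f (inject₁-injective e))
  proper x~y (member _ refl) (oneMiss _ _ _) e = fromℕ≢inject₁ (sym e)
  proper x~y (member _ refl) (manyMiss _ _ _ anc) e =
    ~≁⇒≢ x~y (proj₁ anc) (cong f (inject₁-injective e))
  proper x~y (oneMiss _ _ _) (member _ refl) e = fromℕ≢inject₁ e
  proper x~y (oneMiss out-x _ miss-x) (oneMiss out-y _ miss-y) _ =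
    oneMiss-conflict x~y out-x out-y miss-x miss-y
  proper x~y (oneMiss _ _ _) (manyMiss _ _ _ _) e = fromℕ≢inject₁ e
  proper x~y (manyMiss _ _ _ anc) (member _ refl) e =
    ~≁⇒≢ (~-sym x~y) (proj₁ anc) (cong f (inject₁-injective (sym e)))
  proper x~y (manyMiss _ _ _ _) (oneMiss _ _ _) e = fromℕ≢inject₁ (sym e)
  proper x~y (manyMiss out-x two-x _ anc-x) (manyMiss out-y two-y _ anc-y) e
    with inject₁-injective e
  ... | refl = sharedAnchor-conflict x~y out-x out-y two-x two-y anc-x anc-y

  colouring : Colourable G (suc w)
  colouring = (λ x → colour (classify x)) , λ x y x~y → proper x~y (classify x) (classify y)

theorem2p9 : (G : Graph) (w : ℕ) → 2K2-K1+C4-free G → CliqueNumber G w →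
    3 ≤ w → Colourable G (suc w)
theorem2p9 G w free ((f , clique) , maximum) (s≤s (s≤s (s≤s _))) =
  Colouring.colouring G free f clique maximum
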